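{- For $L$ a complete lattice, the following are equivalent: (1) $L$ is an o-algebra; (2) there exists a binary relation $\bowtie$ on $L$ (the overlap relation) that satisfies the following properties identically: - $x \bowtie y \Longrightarrow y \bowtie x$ (symmetry); - $x \bowtie y \Longrightarrow x \bowtie (x \wedge y)$ (meet closure); - $x \bowtie \bigvee Y \Longrightarrow (\exists y\in Y)(x \bowtie y)$ (splitting of joins); - $(x \bowtie y) \land (y\leq z) \Longrightarrow x \bowtie z$ (monotonicity); - $(\forall z\in L)(z \bowtie x \Rightarrow z \bowtie y) \Longrightarrow x \leq y$ (density).
   Context: Work in intuitionistic logic without choice. A positivity predicate on a complete lattice $L$ is a unary predicate $\mathrm{Pos}$ such that: (i) $\mathrm{Pos}(x)$ and $x\le y$ imply $\mathrm{Pos}(y)$; (ii) $\mathrm{Pos}(\bigvee X)$ implies $\mathrm{Pos}(x)$ for some $x\in X$; (iii) if $\mathrm{Pos}(x)\Rightarrow x\le y$, then $x\le y$. A frame with a positivity predicate is called overt. An overlap algebra (o-algebra) is an overt frame $L$ such that for all $x,y\in L$: if $\mathrm{Pos}(z\wedge x)\Rightarrow\mathrm{Pos}(z\wedge y)$ holds for every $z\in L$, then $x\le y$. -}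

module Defs where

open import Level using (Level; _⊔_; suc)
open import Data.Product using (Σ; _×_; _,_)
open import Relation.Binary.PropositionalEquality using (_≡_)
open import Relation.Unary using (Pred; _∈_)
open import Function.Bundles using (_⇔_)

-- A complete lattice: a partial order (antisymmetric w.r.t. propositional
-- equality) with joins of all subsets (predicates of level c ⊔ ℓ) and
-- binary meets (which exist in any complete lattice; included as a field
-- together with their universal property, hence uniquely determined).
record CompleteLattice (c ℓ : Level) : Set (suc (c ⊔ ℓ)) where
  infix 4 _≤_
  infixr 7 _∧_
  field
    Carrier   : Set c
    _≤_       : Carrier → Carrier → Set ℓ
    ≤-refl    : ∀ {x} → x ≤ x
    ≤-trans   : ∀ {x y z} → x ≤ y → y ≤ z → x ≤ z
    ≤-antisym : ∀ {x y} → x ≤ y → y ≤ x → x ≡ y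
    ⋁         : Pred Carrier (c ⊔ ℓ) → Carrier
    ⋁-upper   : ∀ (X : Pred Carrier (c ⊔ ℓ)) {x} → x ∈ X → x ≤ ⋁ X
    ⋁-least   : ∀ (X : Pred Carrier (c ⊔ ℓ)) {z} → (∀ {x} → x ∈ X → x ≤ z) → ⋁ X ≤ z
    _∧_       : Carrier → Carrier → Carrier
    ∧-lowerˡ  : ∀ {x y} → x ∧ y ≤ x
    ∧-lowerʳ  : ∀ {x y} → x ∧ y ≤ y
    ∧-greatest : ∀ {x y z} → z ≤ x → z ≤ y → z ≤ x ∧ y

module _ {c ℓ : Level} (L : CompleteLattice c ℓ) where
  open CompleteLattice L

  meetImage : Carrier → Pred Carrier (c ⊔ ℓ) → Pred Carrier (c ⊔ ℓ)
  meetImage x X z = Σ Carrier (λ y → y ∈ X × z ≡ x ∧ y)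

  IsFrame : Set (suc (c ⊔ ℓ))
  IsFrame = ∀ (x : Carrier) (X : Pred Carrier (c ⊔ ℓ)) → x ∧ ⋁ X ≡ ⋁ (meetImage x X)

  record IsPositivity {p : Level} (Pos : Pred Carrier p) : Set (suc (c ⊔ ℓ) ⊔ p) where
    field
      pos-mono  : ∀ {x y} → Pos x → x ≤ y → Pos y
      pos-split : ∀ (X : Pred Carrier (c ⊔ ℓ)) → Pos (⋁ X) → Σ Carrier (λ x → x ∈ X × Pos x)
      pos-cover : ∀ {x y} → (Pos x → x ≤ y) → x ≤ y

  record IsOAlgebra (p : Level) : Set (suc (c ⊔ ℓ ⊔ p)) where
    field
      isFrame    : IsFrame
      Pos        : Pred Carrier p
      isPositivity : IsPositivity Pos
      density    : ∀ {x y} → (∀ z → Pos (z ∧ x) → Pos (z ∧ y)) → x ≤ y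

  record IsOverlap {p : Level} (_⋈_ : Carrier → Carrier → Set p) : Set (suc (c ⊔ ℓ) ⊔ p) where
    field
      ⋈-sym     : ∀ {x y} → x ⋈ y → y ⋈ x
      ⋈-meet    : ∀ {x y} → x ⋈ y → x ⋈ (x ∧ y)
      ⋈-split   : ∀ {x} (Y : Pred Carrier (c ⊔ ℓ)) → x ⋈ ⋁ Y → Σ Carrier (λ y → y ∈ Y × x ⋈ y)
      ⋈-mono    : ∀ {x y z} → x ⋈ y → y ≤ z → x ⋈ z
      ⋈-density : ∀ {x y} → (∀ z → z ⋈ x → z ⋈ y) → x ≤ y

-- The two structures determine each other:
--   * from a positivity predicate one gets the overlap  x ⋈ y := Pos (x ∧ y);
--   * from an overlap relation one gets the positivity  Pos x := x ⋈ x.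
-- The backward direction rests on one bridge fact: every overlap
-- relation satisfies  x ⋈ y ⇔ Pos (x ∧ y).  With it, the positivity axioms,
-- the o-algebra density and the frame distributivity law all reduce to
-- overlap density.
module Submission where

open import Defs
open import Level using (Level; _⊔_)
open import Data.Product using (Σ; _,_; _×_)
open import Function.Bundles using (_⇔_; mk⇔)
open import Relation.Binary.PropositionalEquality using (_≡_; refl; subst)
open import Relation.Unary using (Pred; _∈_)

module MeetLemmas {c ℓ : Level} (L : CompleteLattice c ℓ) where
  open CompleteLattice L

  ∧-mono : ∀ {a b x y} → a ≤ b → x ≤ y → a ∧ x ≤ b ∧ y
  ∧-mono a≤b x≤y = ∧-greatest (≤-trans ∧-lowerˡ a≤b) (≤-trans ∧-lowerʳ x≤y)

  ∧-monoʳ : ∀ {a x y} → x ≤ y → a ∧ x ≤ a ∧ y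
  ∧-monoʳ = ∧-mono ≤-refl

  ∧-comm-≤ : ∀ {x y} → x ∧ y ≤ y ∧ x
  ∧-comm-≤ = ∧-greatest ∧-lowerʳ ∧-lowerˡ

  ∧-assoc-≤ : ∀ {x y z} → (x ∧ y) ∧ z ≤ x ∧ (y ∧ z)
  ∧-assoc-≤ = ∧-greatest (≤-trans ∧-lowerˡ ∧-lowerˡ) (∧-mono ∧-lowerʳ ≤-refl)

  ∧-absorb-≤ : ∀ {x y} → x ∧ y ≤ x ∧ (x ∧ y)
  ∧-absorb-≤ = ∧-greatest ∧-lowerˡ ≤-refl

module MeetOverlap {c ℓ p : Level} (L : CompleteLattice c ℓ)
  (Pos : Pred (CompleteLattice.Carrier L) p)
  (pos-mono : ∀ {x y} → Pos x → CompleteLattice._≤_ L x y → Pos y) where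
  open CompleteLattice L
  open MeetLemmas L

  _⋈_ : Carrier → Carrier → Set p
  x ⋈ y = Pos (x ∧ y)

  ⋈-sym : ∀ {x y} → x ⋈ y → y ⋈ x
  ⋈-sym h = pos-mono h ∧-comm-≤

  ⋈-meet : ∀ {x y} → x ⋈ y → x ⋈ (x ∧ y)
  ⋈-meet h = pos-mono h ∧-absorb-≤

  ⋈-mono : ∀ {x y z} → x ⋈ y → y ≤ z → x ⋈ z
  ⋈-mono h y≤z = pos-mono h (∧-monoʳ y≤z)

  -- In a frame, x ∧ ⋁ Y is the join of the meets x ∧ y, so a predicate
  -- splitting joins makes the meet-overlap split joins.
  ⋈-split : IsFrame L →
            (∀ (X : Pred Carrier (c ⊔ ℓ)) → Pos (⋁ X) → Σ Carrier (λ x → x ∈ X × Pos x)) →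
            ∀ {x} (Y : Pred Carrier (c ⊔ ℓ)) → x ⋈ ⋁ Y → Σ Carrier (λ y → y ∈ Y × x ⋈ y)
  ⋈-split frame split {x} Y h
    with split (meetImage L x Y) (subst Pos (frame x Y) h)
  ... | _ , (y , y∈Y , refl) , pos = y , y∈Y , pos

oAlgebra⇒overlap : ∀ {c ℓ p} (L : CompleteLattice c ℓ) →
                   IsOAlgebra L p → Σ (CompleteLattice.Carrier L → CompleteLattice.Carrier L → Set p) (IsOverlap L)
oAlgebra⇒overlap L oa = _⋈_ , record
  { ⋈-sym     = ⋈-sym
  ; ⋈-meet    = ⋈-meet
  ; ⋈-split   = ⋈-split isFrame pos-split
  ; ⋈-mono    = ⋈-mono
  ; ⋈-density = density
  }
  where
  open IsOAlgebra oa
  open IsPositivity isPositivity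
  open MeetOverlap L Pos pos-mono

module OverlapPositivity {c ℓ p : Level} (L : CompleteLattice c ℓ)
  {_⋈_ : CompleteLattice.Carrier L → CompleteLattice.Carrier L → Set p}
  (isOverlap : IsOverlap L _⋈_) where
  open CompleteLattice L
  open MeetLemmas L
  open IsOverlap isOverlap

  Pos : Pred Carrier p
  Pos x = x ⋈ x

  ⋈⇒Posˡ : ∀ {x y} → x ⋈ y → Pos x
  ⋈⇒Posˡ h = ⋈-mono (⋈-meet h) ∧-lowerˡ

  ⋈⇒Posʳ : ∀ {x y} → x ⋈ y → Pos y
  ⋈⇒Posʳ h = ⋈⇒Posˡ (⋈-sym h)

  Pos-mono : ∀ {x y} → Pos x → x ≤ y → Pos y
  Pos-mono h x≤y = ⋈⇒Posʳ (⋈-mono h x≤y)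

  ⋈⇒Pos-∧ : ∀ {x y} → x ⋈ y → Pos (x ∧ y)
  ⋈⇒Pos-∧ h = ⋈⇒Posʳ (⋈-meet h)

  Pos-∧⇒⋈ : ∀ {x y} → Pos (x ∧ y) → x ⋈ y
  Pos-∧⇒⋈ h = ⋈-mono (⋈-sym (⋈-mono h ∧-lowerˡ)) ∧-lowerʳ

  isPositivity : IsPositivity L Pos
  isPositivity = record
    { pos-mono  = Pos-mono
    ; pos-split = λ X h → let (x , x∈X , r) = ⋈-split X h in x , x∈X , ⋈⇒Posʳ r
    ; pos-cover = λ f → ⋈-density (λ z r → ⋈-mono r (f (⋈⇒Posʳ r)))
    }

  -- O-algebra density is overlap density read through the bridge.
  Pos-density : ∀ {x y} → (∀ z → Pos (z ∧ x) → Pos (z ∧ y)) → x ≤ y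
  Pos-density f = ⋈-density (λ z r → Pos-∧⇒⋈ (f z (⋈⇒Pos-∧ r)))

  -- If z overlaps x ∧ ⋁ Y, then z ∧ (x ∧ ⋁ Y) overlaps ⋁ Y,
  -- hence some y ∈ Y; so z overlaps x ∧ y, which lies below the join.
  ∧-distrib-⋁-≤ : ∀ x (Y : Pred Carrier (c ⊔ ℓ)) → x ∧ ⋁ Y ≤ ⋁ (meetImage L x Y)
  ∧-distrib-⋁-≤ x Y = ⋈-density λ z r →
    let a = z ∧ (x ∧ ⋁ Y)
        (y , y∈Y , a⋈y) = ⋈-split Y (⋈-mono (⋈⇒Pos-∧ r) (≤-trans ∧-lowerʳ ∧-lowerʳ))
        a∧y≤z∧x∧y : a ∧ y ≤ z ∧ (x ∧ y)
        a∧y≤z∧x∧y = ≤-trans ∧-assoc-≤ (∧-monoʳ (∧-mono ∧-lowerˡ ≤-refl))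
        z⋈x∧y : z ⋈ (x ∧ y)
        z⋈x∧y = Pos-∧⇒⋈ (Pos-mono (⋈⇒Pos-∧ a⋈y) a∧y≤z∧x∧y)
    in ⋈-mono z⋈x∧y (⋁-upper (meetImage L x Y) (y , y∈Y , refl))

  ⋁-meetImage-≤ : ∀ x (Y : Pred Carrier (c ⊔ ℓ)) → ⋁ (meetImage L x Y) ≤ x ∧ ⋁ Y
  ⋁-meetImage-≤ x Y = ⋁-least (meetImage L x Y) λ where
    (y , y∈Y , refl) → ∧-monoʳ (⋁-upper Y y∈Y)

  isFrame : IsFrame L
  isFrame x Y = ≤-antisym (∧-distrib-⋁-≤ x Y) (⋁-meetImage-≤ x Y)

overlap⇒oAlgebra : ∀ {c ℓ p} (L : CompleteLattice c ℓ) →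
                   Σ (CompleteLattice.Carrier L → CompleteLattice.Carrier L → Set p) (IsOverlap L) →
                   IsOAlgebra L p
overlap⇒oAlgebra L (_ , isOverlap) = record
  { isFrame      = isFrame
  ; Pos          = Pos
  ; isPositivity = isPositivity
  ; density      = Pos-density
  }
  where open OverlapPositivity L isOverlap

proposition2p3 : ∀ {c ℓ p : Level} (L : CompleteLattice c ℓ) →
    IsOAlgebra L p ⇔ Σ (CompleteLattice.Carrier L → CompleteLattice.Carrier L → Set p) (λ R → IsOverlap L R)
proposition2p3 L = mk⇔ (oAlgebra⇒overlap L) (overlap⇒oAlgebra L)
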